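{- For every positive integer $n$, the number of three-candidate ballot sequences of length $n$ with matching parity equals the $n$-th Riordan number $R(n)$.
   Context: A three-candidate ballot sequence of length $n$ is a string $b_1\cdots b_n$ with $b_i\in\{A,B,C\}$ such that in every prefix $b_1\cdots b_k$ ($1\le k\le n$) the number of $A$'s is at least the number of $B$'s, which is at least the number of $C$'s. It has matching parity if the numbers of $A$'s, $B$'s and $C$'s are all congruent modulo $2$. A Riordan path of length $n$ is a lattice path from $(0,0)$ to $(n,0)$ with steps $U=(1,1)$, $F=(1,0)$, $D=(1,-1)$, never going below the $x$-axis, and with no $F$ step on the $x$-axis; $R(n)$ is the number of such paths. -}

module Defs where

open import Data.Nat using (ℕ; zero; suc; _+_; _≤_; _≤?_; _≟_; _%_)
open import Data.List using (List; []; _∷_; length; filter; map; concatMap; take)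
open import Data.List.Relation.Unary.All using (All)
open import Data.List.Relation.Unary.All using (all?)
open import Relation.Nullary using (Dec; yes; no)
open import Relation.Nullary.Decidable using (_×-dec_)
open import Relation.Binary.PropositionalEquality using (_≡_)
open import Data.Product using (_×_)
open import Data.Empty using (⊥)
open import Data.Unit using (⊤)

allWords : {A : Set} → List A → ℕ → List (List A)
allWords as zero    = [] ∷ []
allWords as (suc n) = concatMap (λ a → map (a ∷_) (allWords as n)) as

prefixes : {A : Set} → List A → List (List A)
prefixes []      = []
prefixes (x ∷ w) = (x ∷ []) ∷ map (x ∷_) (prefixes w)

data Cand : Set where
  A B C : Cand

cands : List Cand
cands = A ∷ B ∷ C ∷ []

_≟c_ : (x y : Cand) → Dec (x ≡ y)
A ≟c A = yes _≡_.refl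
A ≟c B = no λ ()
A ≟c C = no λ ()
B ≟c A = no λ ()
B ≟c B = yes _≡_.refl
B ≟c C = no λ ()
C ≟c A = no λ ()
C ≟c B = no λ ()
C ≟c C = yes _≡_.refl

count : Cand → List Cand → ℕ
count x w = length (filter (x ≟c_) w)

BallotPrefix : List Cand → Set
BallotPrefix p = count B p ≤ count A p × count C p ≤ count B p

IsBallot : List Cand → Set
IsBallot w = All BallotPrefix (prefixes w)

MatchingParity : List Cand → Set
MatchingParity w = (count A w % 2 ≡ count B w % 2) × (count B w % 2 ≡ count C w % 2)

ballotPrefix? : (p : List Cand) → Dec (BallotPrefix p)
ballotPrefix? p = (count B p ≤? count A p) ×-dec (count C p ≤? count B p)

matchingBallot? : (w : List Cand) → Dec (IsBallot w × MatchingParity w)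
matchingBallot? w =
  all? ballotPrefix? (prefixes w)
  ×-dec ((count A w % 2 ≟ count B w % 2) ×-dec (count B w % 2 ≟ count C w % 2))

ballotMatching : ℕ → ℕ
ballotMatching n = length (filter matchingBallot? (allWords cands n))

data Step : Set where
  U F D : Step

steps : List Step
steps = U ∷ F ∷ D ∷ []

-- RiordanFrom h s : the step sequence s, started at height h ≥ 0, never goes
-- below the x-axis, takes no F step on the x-axis (height 0), and ends at height 0.
RiordanFrom : ℕ → List Step → Set
RiordanFrom zero    []      = ⊤
RiordanFrom (suc h) []      = ⊥
RiordanFrom zero    (U ∷ s) = RiordanFrom 1 s
RiordanFrom (suc h) (U ∷ s) = RiordanFrom (suc (suc h)) s
RiordanFrom zero    (F ∷ s) = ⊥
RiordanFrom (suc h) (F ∷ s) = RiordanFrom (suc h) s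
RiordanFrom zero    (D ∷ s) = ⊥
RiordanFrom (suc h) (D ∷ s) = RiordanFrom h s

IsRiordanPath : List Step → Set
IsRiordanPath = RiordanFrom 0

riordanFrom? : (h : ℕ) (s : List Step) → Dec (RiordanFrom h s)
riordanFrom? zero    []      = yes _
riordanFrom? (suc h) []      = no λ ()
riordanFrom? zero    (U ∷ s) = riordanFrom? 1 s
riordanFrom? (suc h) (U ∷ s) = riordanFrom? (suc (suc h)) s
riordanFrom? zero    (F ∷ s) = no λ ()
riordanFrom? (suc h) (F ∷ s) = riordanFrom? (suc h) s
riordanFrom? zero    (D ∷ s) = no λ ()
riordanFrom? (suc h) (D ∷ s) = riordanFrom? h s

R : ℕ → ℕ
R n = length (filter (riordanFrom? 0) (allWords steps n))

module Submission where

-- Both numbers count the SO(3)-invariants in (ℂ³)^⊗n. Tensoring the spin-h representation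
-- with ℂ³ gives spins h + 1, h, h − 1 (only spin 1 when h = 0), so R(n) is the multiplicity of
-- spin 0. Ballot words of length n ending at (a, b) = (#A − #B, #B − #C) count the copies of
-- the sl₃-irreducible V(a, b) in (ℂ³)^⊗n, and V(a, b) contains an SO(3)-invariant (exactly
-- one) iff a and b are even.
-- The proof is the combinatorial shadow of restricting V(a, b) to SO(3): the branching
-- multiplicities turn a count of Riordan paths into a count of ballot continuations, and they
-- intertwine the two transfer operators (a Pieri rule), so induction on n transports the
-- equality from n = 0. In ρ-shifted coordinates (a + 1, b + 1) the chamber walls are the lines
-- where a coordinate vanishes, and both sides vanish there.

open import Defs
open import Data.Bool using (true; false)
open import Data.Empty using (⊥)
open import Data.List using (List; []; _∷_; _++_; length; filter; map; concatMap)
open import Data.Nat.ListAction using (sum)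
open import Data.List.Properties using (length-++; filter-++; filter-none; filter-reject)
open import Data.List.Relation.Unary.All as All using (All; []; _∷_)
open import Data.List.Relation.Unary.All.Properties using (map⁺; map⁻)
open import Data.Nat using (ℕ; zero; suc; _+_; _≤_; _≥_; _%_; _≟_; z≤n; s≤s; s≤s⁻¹)
open import Data.Nat.DivMod using (%-distribˡ-+)
open import Data.Nat.Properties using (+-suc; +-identityʳ; +-assoc)
open import Data.Nat.Tactic.RingSolver using (solve-∀)
open import Data.Product using (_×_; _,_; proj₂)
open import Data.Product.Function.NonDependent.Propositional using (_×-⇔_)
open import Function using (_∘_; _⇔_; mk⇔; Equivalence)
open import Function.Construct.Composition using (_⇔-∘_)
open import Function.Construct.Identity using (⇔-id)
open import Relation.Nullary using (¬_; does; yes; no; _×-dec_; contradiction)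
open import Relation.Unary using (Pred; Decidable)
open import Relation.Binary.PropositionalEquality
  using (_≡_; refl; sym; trans; cong; cong₂; _≗_; module ≡-Reasoning)

open ≡-Reasoning

module _ {a p} {X : Set a} {P : Pred X p} (P? : Decidable P) where

  count-++ : ∀ xs ys →
    length (filter P? (xs ++ ys)) ≡ length (filter P? xs) + length (filter P? ys)
  count-++ xs ys = trans (cong length (filter-++ P? xs ys)) (length-++ (filter P? xs))

  count-none : (∀ x → ¬ P x) → ∀ xs → length (filter P? xs) ≡ 0
  count-none ¬P xs = cong length (filter-none P? (All.universal ¬P xs))

  count-map : ∀ {b} {Y : Set b} (f : Y → X) ys →
    length (filter P? (map f ys)) ≡ length (filter (P? ∘ f) ys)
  count-map f [] = refl
  count-map f (y ∷ ys) with does (P? (f y))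
  ... | true  = cong suc (count-map f ys)
  ... | false = count-map f ys

count-⇔ : ∀ {a p q} {X : Set a} {P : Pred X p} {Q : Pred X q}
  (P? : Decidable P) (Q? : Decidable Q) {xs : List X} →
  All (λ x → P x ⇔ Q x) xs → length (filter P? xs) ≡ length (filter Q? xs)
count-⇔ P? Q? []                         = refl
count-⇔ P? Q? {x ∷ _} (P⇔Q ∷ P⇔Qs) with P? x | Q? x
... | yes _  | yes _ = cong suc (count-⇔ P? Q? P⇔Qs)
... | no _   | no _  = count-⇔ P? Q? P⇔Qs
... | yes Px | no ¬Q = contradiction (Equivalence.to P⇔Q Px) ¬Q
... | no ¬P  | yes Q = contradiction (Equivalence.from P⇔Q Q) ¬P

module _ {X : Set} {p} {P : Pred (List X) p} (P? : Decidable P) where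

  count-allWords-suc : ∀ letters n →
    length (filter P? (allWords letters (suc n)))
      ≡ sum (map (λ c → length (filter (P? ∘ (c ∷_)) (allWords letters n))) letters)
  count-allWords-suc letters n = go letters
    where
    go : ∀ cs →
      length (filter P? (concatMap (λ c → map (c ∷_) (allWords letters n)) cs))
        ≡ sum (map (λ c → length (filter (P? ∘ (c ∷_)) (allWords letters n))) cs)
    go []       = refl
    go (c ∷ cs) = trans (count-++ P? (map (c ∷_) (allWords letters n)) _)
                        (cong₂ _+_ (count-map P? (c ∷_) (allWords letters n)) (go cs))

  count-allWords₃-suc : ∀ x y z n →
    let after : X → ℕ
        after c = length (filter (P? ∘ (c ∷_)) (allWords (x ∷ y ∷ z ∷ []) n))
    in length (filter P? (allWords (x ∷ y ∷ z ∷ []) (suc n))) ≡ after x + after y + after z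
  count-allWords₃-suc x y z n =
    trans (count-allWords-suc (x ∷ y ∷ z ∷ []) n) (sum₃ (after x) (after y) (after z))
    where
    after : X → ℕ
    after c = length (filter (P? ∘ (c ∷_)) (allWords (x ∷ y ∷ z ∷ []) n))
    sum₃ : ∀ a b c → a + (b + (c + 0)) ≡ a + b + c
    sum₃ = solve-∀

riordanPaths : ℕ → ℕ → ℕ
riordanPaths n h = length (filter (riordanFrom? h) (allWords steps n))

riordanStep : (ℕ → ℕ) → ℕ → ℕ
riordanStep g zero    = g 1
riordanStep g (suc h) = g (suc (suc h)) + g (suc h) + g h

riordanPaths-suc : ∀ n → riordanPaths (suc n) ≗ riordanStep (riordanPaths n)
riordanPaths-suc n (suc h) = count-allWords₃-suc (riordanFrom? (suc h)) U F D n
riordanPaths-suc n zero = begin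
  riordanPaths (suc n) 0
    ≡⟨ count-allWords₃-suc (riordanFrom? 0) U F D n ⟩
  riordanPaths n 1 + length (filter (riordanFrom? 0 ∘ (F ∷_)) W)
                   + length (filter (riordanFrom? 0 ∘ (D ∷_)) W)
    ≡⟨ cong₂ (λ f d → riordanPaths n 1 + f + d)
             (count-none (riordanFrom? 0 ∘ (F ∷_)) (λ _ ()) W)
             (count-none (riordanFrom? 0 ∘ (D ∷_)) (λ _ ()) W) ⟩
  riordanPaths n 1 + 0 + 0
    ≡⟨ trans (+-identityʳ _) (+-identityʳ _) ⟩
  riordanPaths n 1 ∎
  where
  W : List (List Step)
  W = allWords steps n

intervalSum : (ℕ → ℕ) → ℕ → ℕ → ℕ
intervalSum g a zero    = 0
intervalSum g a (suc k) = g a + intervalSum g (suc a) k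

alternateSum : (ℕ → ℕ) → ℕ → ℕ
alternateSum g zero          = 0
alternateSum g (suc zero)    = g 0
alternateSum g (suc (suc x)) = g (suc x) + alternateSum g x

-- branching g (a + 1) (b + 1) = Σₕ mₕ g h, where mₕ is the multiplicity of spin h in V(a, b)
-- restricted to SO(3).
branching : (ℕ → ℕ) → ℕ → ℕ → ℕ
branching g x zero          = 0
branching g x (suc zero)    = alternateSum g x
branching g x (suc (suc y)) = branching g x y + intervalSum g (suc y) x

intervalSum-cong : ∀ {f g} → f ≗ g → ∀ a k → intervalSum f a k ≡ intervalSum g a k
intervalSum-cong f≗g a zero    = refl
intervalSum-cong f≗g a (suc k) = cong₂ _+_ (f≗g a) (intervalSum-cong f≗g (suc a) k)

alternateSum-cong : ∀ {f g} → f ≗ g → ∀ x → alternateSum f x ≡ alternateSum g x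
alternateSum-cong f≗g zero          = refl
alternateSum-cong f≗g (suc zero)    = f≗g 0
alternateSum-cong f≗g (suc (suc x)) = cong₂ _+_ (f≗g (suc x)) (alternateSum-cong f≗g x)

branching-cong : ∀ {f g} → f ≗ g → ∀ x y → branching f x y ≡ branching g x y
branching-cong f≗g x zero          = refl
branching-cong f≗g x (suc zero)    = alternateSum-cong f≗g x
branching-cong f≗g x (suc (suc y)) =
  cong₂ _+_ (branching-cong f≗g x y) (intervalSum-cong f≗g (suc y) x)

intervalSum-snoc : ∀ g a k → intervalSum g a (suc k) ≡ intervalSum g a k + g (a + k)
intervalSum-snoc g a zero    = trans (+-identityʳ (g a)) (cong g (sym (+-identityʳ a)))
intervalSum-snoc g a (suc k) = begin
  g a + intervalSum g (suc a) (suc k)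
    ≡⟨ cong (g a +_) (intervalSum-snoc g (suc a) k) ⟩
  g a + (intervalSum g (suc a) k + g (suc (a + k)))
    ≡⟨ sym (+-assoc (g a) _ _) ⟩
  g a + intervalSum g (suc a) k + g (suc (a + k))
    ≡⟨ cong (λ m → g a + intervalSum g (suc a) k + g m) (sym (+-suc a k)) ⟩
  g a + intervalSum g (suc a) k + g (a + suc k) ∎

intervalSum-riordanStep : ∀ g a k →
  intervalSum (riordanStep g) (suc a) k
    ≡ intervalSum g (suc (suc a)) k + intervalSum g (suc a) k + intervalSum g a k
intervalSum-riordanStep g a zero    = refl
intervalSum-riordanStep g a (suc k) =
  trans (cong (riordanStep g (suc a) +_) (intervalSum-riordanStep g (suc a) k))
        (interchange (g (suc (suc a))) (g (suc a)) (g a)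
                     (intervalSum g (suc (suc (suc a))) k) (intervalSum g (suc (suc a)) k)
                     (intervalSum g (suc a) k))
  where
  interchange : ∀ a b c d e f → a + b + c + (d + e + f) ≡ a + d + (b + e) + (c + f)
  interchange = solve-∀

alternateSum-pair : ∀ g x →
  alternateSum g x + alternateSum g (suc x) ≡ intervalSum g 0 (suc x)
alternateSum-pair g zero    = sym (+-identityʳ (g 0))
alternateSum-pair g (suc x) = begin
  alternateSum g (suc x) + (g (suc x) + alternateSum g x)
    ≡⟨ rotate (alternateSum g (suc x)) (g (suc x)) (alternateSum g x) ⟩
  alternateSum g x + alternateSum g (suc x) + g (suc x)
    ≡⟨ cong (_+ g (suc x)) (alternateSum-pair g x) ⟩
  intervalSum g 0 (suc x) + g (suc x)
    ≡⟨ sym (intervalSum-snoc g 0 (suc x)) ⟩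
  intervalSum g 0 (suc (suc x)) ∎
  where
  rotate : ∀ a b c → a + (b + c) ≡ c + a + b
  rotate = solve-∀

alternateSum-riordanStep : ∀ g x →
  alternateSum (riordanStep g) (suc x) ≡ alternateSum g (suc (suc x)) + intervalSum g 1 x
alternateSum-riordanStep g zero          = sym (trans (+-identityʳ _) (+-identityʳ (g 1)))
alternateSum-riordanStep g (suc zero)    = reorder (g 2) (g 1) (g 0)
  where
  reorder : ∀ a b c → a + b + c + 0 ≡ a + c + (b + 0)
  reorder = solve-∀
alternateSum-riordanStep g (suc (suc x)) = begin
  g₃ + g₂ + g₁ + alternateSum (riordanStep g) (suc x)
    ≡⟨ cong (g₃ + g₂ + g₁ +_) (alternateSum-riordanStep g x) ⟩
  g₃ + g₂ + g₁ + (alternateSum g (suc (suc x)) + intervalSum g 1 x)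
    ≡⟨ reorder g₃ g₂ g₁ (alternateSum g (suc (suc x))) (intervalSum g 1 x) ⟩
  g₃ + alternateSum g (suc (suc x)) + (intervalSum g 1 x + g₁ + g₂)
    ≡⟨ cong (g₃ + alternateSum g (suc (suc x)) +_) (sym intervalSum-snoc²) ⟩
  alternateSum g (suc (suc (suc (suc x)))) + intervalSum g 1 (suc (suc x)) ∎
  where
  g₁ g₂ g₃ : ℕ
  g₁ = g (suc x)
  g₂ = g (suc (suc x))
  g₃ = g (suc (suc (suc x)))
  reorder : ∀ a b c d e → a + b + c + (d + e) ≡ a + d + (e + c + b)
  reorder = solve-∀
  intervalSum-snoc² : intervalSum g 1 (suc (suc x)) ≡ intervalSum g 1 x + g₁ + g₂
  intervalSum-snoc² =
    trans (intervalSum-snoc g 1 (suc x)) (cong (_+ g₂) (intervalSum-snoc g 1 x))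

branching-wall : ∀ g y → branching g 0 y ≡ 0
branching-wall g zero          = refl
branching-wall g (suc zero)    = refl
branching-wall g (suc (suc y)) = trans (+-identityʳ _) (branching-wall g y)

-- The Pieri rule V(a, b) ⊗ ℂ³ ≅ V(a + 1, b) ⊕ V(a − 1, b + 1) ⊕ V(a, b − 1), restricted to SO(3).
branching-riordanStep : ∀ g x y →
  branching (riordanStep g) (suc x) (suc y)
    ≡ branching g (suc (suc x)) (suc y) + branching g x (suc (suc y)) + branching g (suc x) y
branching-riordanStep g x zero          =
  trans (alternateSum-riordanStep g x) (sym (+-identityʳ _))
branching-riordanStep g x (suc zero)    = begin
  intervalSum (riordanStep g) 1 (suc x)
    ≡⟨ intervalSum-riordanStep g 0 (suc x) ⟩
  intervalSum g 2 (suc x) + intervalSum g 1 (suc x) + intervalSum g 0 (suc x)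
    ≡⟨ cong (intervalSum g 2 (suc x) + intervalSum g 1 (suc x) +_) (sym (alternateSum-pair g x)) ⟩
  intervalSum g 2 (suc x) + (g 1 + intervalSum g 2 x) + (alternateSum g x + alternateSum g (suc x))
    ≡⟨ reorder (intervalSum g 2 (suc x)) (g 1) (intervalSum g 2 x)
               (alternateSum g x) (alternateSum g (suc x)) ⟩
  g 1 + intervalSum g 2 (suc x) + (alternateSum g x + intervalSum g 2 x) + alternateSum g (suc x) ∎
  where
  reorder : ∀ a b c d e → a + (b + c) + (d + e) ≡ b + a + (d + c) + e
  reorder = solve-∀
branching-riordanStep g x (suc (suc y)) = begin
  branching (riordanStep g) (suc x) (suc y) + intervalSum (riordanStep g) (suc (suc y)) (suc x)
    ≡⟨ cong₂ _+_ (branching-riordanStep g x y) (intervalSum-riordanStep g (suc y) (suc x)) ⟩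
  b₁ + b₂ + b₃ + (s + (gₘ + t) + u)
    ≡⟨ reorder b₁ b₂ b₃ s gₘ t u ⟩
  b₁ + (gₘ + s) + (b₂ + t) + (b₃ + u) ∎
  where
  b₁ b₂ b₃ gₘ s t u : ℕ
  b₁ = branching g (suc (suc x)) (suc y)
  b₂ = branching g x (suc (suc y))
  b₃ = branching g (suc x) y
  gₘ = g (suc (suc y))
  s  = intervalSum g (suc (suc (suc y))) (suc x)
  t  = intervalSum g (suc (suc (suc y))) x
  u  = intervalSum g (suc y) (suc x)
  reorder : ∀ b₁ b₂ b₃ s g t u →
    b₁ + b₂ + b₃ + (s + (g + t) + u) ≡ b₁ + (g + s) + (b₂ + t) + (b₃ + u)
  reorder = solve-∀

-- The state (x, y) is (#A − #B + 1, #B − #C + 1); the walk dies when a coordinate reaches 0.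
BallotWalk : ℕ → ℕ → List Cand → Set
BallotWalk zero    _       _       = ⊥
BallotWalk (suc x) zero    _       = ⊥
BallotWalk (suc x) (suc y) []      = x % 2 ≡ 0 × y % 2 ≡ 0
BallotWalk (suc x) (suc y) (A ∷ w) = BallotWalk (suc (suc x)) (suc y) w
BallotWalk (suc x) (suc y) (B ∷ w) = BallotWalk x (suc (suc y)) w
BallotWalk (suc x) (suc y) (C ∷ w) = BallotWalk (suc x) y w

ballotWalk? : ∀ x y → Decidable (BallotWalk x y)
ballotWalk? zero    _       _       = no λ ()
ballotWalk? (suc x) zero    _       = no λ ()
ballotWalk? (suc x) (suc y) []      = x % 2 ≟ 0 ×-dec y % 2 ≟ 0
ballotWalk? (suc x) (suc y) (A ∷ w) = ballotWalk? (suc (suc x)) (suc y) w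
ballotWalk? (suc x) (suc y) (B ∷ w) = ballotWalk? x (suc (suc y)) w
ballotWalk? (suc x) (suc y) (C ∷ w) = ballotWalk? (suc x) y w

ballotWalks : ℕ → ℕ → ℕ → ℕ
ballotWalks n x y = length (filter (ballotWalk? x y) (allWords cands n))

ballotWalks-wallˣ : ∀ n y → ballotWalks n 0 y ≡ 0
ballotWalks-wallˣ n y = count-none (ballotWalk? 0 y) (λ _ ()) (allWords cands n)

ballotWalks-wallʸ : ∀ n x → ballotWalks n (suc x) 0 ≡ 0
ballotWalks-wallʸ n x = count-none (ballotWalk? (suc x) 0) (λ _ ()) (allWords cands n)

ballotWalks-suc : ∀ n x y →
  ballotWalks (suc n) (suc x) (suc y)
    ≡ ballotWalks n (suc (suc x)) (suc y) + ballotWalks n x (suc (suc y)) + ballotWalks n (suc x) y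
ballotWalks-suc n x y = count-allWords₃-suc (ballotWalk? (suc x) (suc y)) A B C n

intervalSum-riordanPaths₀ : ∀ a k → intervalSum (riordanPaths 0) (suc a) k ≡ 0
intervalSum-riordanPaths₀ a zero    = refl
intervalSum-riordanPaths₀ a (suc k) = intervalSum-riordanPaths₀ (suc a) k

-- The deciders at x and x + 2 agree on [], the only word of length 0, but not on longer words;
-- hence count-⇔ rather than refl.
ballotWalks≡branching₀ : ∀ x y →
  ballotWalks 0 (suc x) (suc y) ≡ branching (riordanPaths 0) (suc x) (suc y)
ballotWalks≡branching₀ zero          zero          = refl
ballotWalks≡branching₀ (suc zero)    zero          = refl
ballotWalks≡branching₀ (suc (suc x)) zero          = begin
  ballotWalks 0 (suc (suc (suc x))) 1
    ≡⟨ count-⇔ (ballotWalk? (suc (suc (suc x))) 1) (ballotWalk? (suc x) 1)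
               {[] ∷ []} (⇔-id _ ∷ []) ⟩
  ballotWalks 0 (suc x) 1
    ≡⟨ ballotWalks≡branching₀ x zero ⟩
  alternateSum (riordanPaths 0) (suc x) ∎
ballotWalks≡branching₀ x             (suc zero)    = begin
  ballotWalks 0 (suc x) 2
    ≡⟨ cong length (filter-reject (ballotWalk? (suc x) 2) {[]} {[]} λ ()) ⟩
  0
    ≡⟨ sym (intervalSum-riordanPaths₀ 0 (suc x)) ⟩
  intervalSum (riordanPaths 0) 1 (suc x) ∎
ballotWalks≡branching₀ x             (suc (suc y)) = begin
  ballotWalks 0 (suc x) (suc (suc (suc y)))
    ≡⟨ count-⇔ (ballotWalk? (suc x) (suc (suc (suc y)))) (ballotWalk? (suc x) (suc y))
               {[] ∷ []} (⇔-id _ ∷ []) ⟩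
  ballotWalks 0 (suc x) (suc y)
    ≡⟨ ballotWalks≡branching₀ x y ⟩
  branching (riordanPaths 0) (suc x) (suc y)
    ≡⟨ sym (+-identityʳ _) ⟩
  branching (riordanPaths 0) (suc x) (suc y) + 0
    ≡⟨ cong (branching (riordanPaths 0) (suc x) (suc y) +_)
            (sym (intervalSum-riordanPaths₀ (suc y) (suc x))) ⟩
  branching (riordanPaths 0) (suc x) (suc (suc (suc y))) ∎

ballotWalks≡branching : ∀ n x y → ballotWalks n x y ≡ branching (riordanPaths n) x y
ballotWalks≡branching n       zero    y       =
  trans (ballotWalks-wallˣ n y) (sym (branching-wall (riordanPaths n) y))
ballotWalks≡branching n       (suc x) zero    = ballotWalks-wallʸ n x
ballotWalks≡branching zero    (suc x) (suc y) = ballotWalks≡branching₀ x y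
ballotWalks≡branching (suc n) (suc x) (suc y) = begin
  ballotWalks (suc n) (suc x) (suc y)
    ≡⟨ ballotWalks-suc n x y ⟩
  ballotWalks n (suc (suc x)) (suc y) + ballotWalks n x (suc (suc y)) + ballotWalks n (suc x) y
    ≡⟨ cong₂ _+_ (cong₂ _+_ (ih (suc (suc x)) (suc y)) (ih x (suc (suc y)))) (ih (suc x) y) ⟩
  branching g (suc (suc x)) (suc y) + branching g x (suc (suc y)) + branching g (suc x) y
    ≡⟨ sym (branching-riordanStep g x y) ⟩
  branching (riordanStep g) (suc x) (suc y)
    ≡⟨ branching-cong (sym ∘ riordanPaths-suc n) (suc x) (suc y) ⟩
  branching (riordanPaths (suc n)) (suc x) (suc y) ∎
  where
  g : ℕ → ℕ
  g = riordanPaths n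
  ih : ∀ x y → ballotWalks n x y ≡ branching g x y
  ih = ballotWalks≡branching n

SameParity : ℕ → ℕ → Set
SameParity m n = m % 2 ≡ n % 2

-- The tallies of p compared by R, as if a word with #A − #B = x and #B − #C = y preceded p.
-- For x = y = 0 this is BallotPrefix when R = _≥_ and MatchingParity when R = SameParity.
Offset : (ℕ → ℕ → Set) → ℕ → ℕ → List Cand → Set
Offset R x y p = R (x + count A p) (count B p) × R (y + count B p) (count C p)

MatchingBallotFrom : ℕ → ℕ → List Cand → Set
MatchingBallotFrom x y w = All (Offset _≥_ x y) (prefixes w) × Offset SameParity x y w

ShiftInvariant : (ℕ → ℕ → Set) → Set
ShiftInvariant R = ∀ m n → R (suc m) (suc n) ⇔ R m n

≥-shiftInvariant : ShiftInvariant _≥_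
≥-shiftInvariant m n = mk⇔ s≤s⁻¹ s≤s

-- (2 + m) % 2 reduces to m % 2, so one direction is the other one shifted by one.
sameParity-shiftInvariant : ShiftInvariant SameParity
sameParity-shiftInvariant m n = mk⇔ (suc-cong {suc m} {suc n}) (suc-cong {m} {n})
  where
  suc-cong : ∀ {m n} → SameParity m n → SameParity (suc m) (suc n)
  suc-cong {m} {n} m≡n = begin
    (1 + m) % 2            ≡⟨ %-distribˡ-+ 1 m 2 ⟩
    (1 + m % 2) % 2        ≡⟨ cong (λ r → (1 + r) % 2) m≡n ⟩
    (1 + n % 2) % 2        ≡⟨ sym (%-distribˡ-+ 1 n 2) ⟩
    (1 + n) % 2            ∎

offset-A : ∀ R x y p → Offset R x y (A ∷ p) ⇔ Offset R (suc x) y p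
offset-A R x y p rewrite +-suc x (count A p) = ⇔-id _

offset-B : ∀ {R} → ShiftInvariant R →
  ∀ x y p → Offset R (suc x) y (B ∷ p) ⇔ Offset R x (suc y) p
offset-B shift x y p rewrite +-suc y (count B p) = shift _ _ ×-⇔ ⇔-id _

offset-C : ∀ {R} → ShiftInvariant R →
  ∀ x y p → Offset R x (suc y) (C ∷ p) ⇔ Offset R x y p
offset-C shift x y p = ⇔-id _ ×-⇔ shift _ _

matchingBallotFrom-∷ : ∀ {x y x′ y′} c w → Offset _≥_ x y (c ∷ []) →
  (∀ {R} → ShiftInvariant R → ∀ p → Offset R x y (c ∷ p) ⇔ Offset R x′ y′ p) →
  MatchingBallotFrom x y (c ∷ w) ⇔ MatchingBallotFrom x′ y′ w
matchingBallotFrom-∷ {x} {y} {x′} {y′} c w first step =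
  prefixes-∷ ×-⇔ step sameParity-shiftInvariant w
  where
  prefixes-∷ :
    All (Offset _≥_ x y) (prefixes (c ∷ w)) ⇔ All (Offset _≥_ x′ y′) (prefixes w)
  prefixes-∷ = mk⇔
    (λ { (_ ∷ ps) → All.map (λ {p} → to (step ≥-shiftInvariant p)) (map⁻ ps) })
    (λ ps → first ∷ map⁺ (All.map (λ {p} → from (step ≥-shiftInvariant p)) ps))
    where open Equivalence

matchingBallotFrom⇔ballotWalk : ∀ x y w →
  MatchingBallotFrom x y w ⇔ BallotWalk (suc x) (suc y) w
matchingBallotFrom⇔ballotWalk x y [] rewrite +-identityʳ x | +-identityʳ y = mk⇔ proj₂ ([] ,_)
matchingBallotFrom⇔ballotWalk x y (A ∷ w) =
  matchingBallotFrom⇔ballotWalk (suc x) y w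
    ⇔-∘ matchingBallotFrom-∷ A w (z≤n , z≤n) (λ {R} _ → offset-A R x y)
matchingBallotFrom⇔ballotWalk zero y (B ∷ w) = mk⇔ (λ { (((() , _) ∷ _) , _) }) λ ()
matchingBallotFrom⇔ballotWalk (suc x) y (B ∷ w) =
  matchingBallotFrom⇔ballotWalk x (suc y) w
    ⇔-∘ matchingBallotFrom-∷ B w (s≤s z≤n , z≤n) (λ shift → offset-B shift x y)
matchingBallotFrom⇔ballotWalk x zero (C ∷ w) = mk⇔ (λ { (((_ , ()) ∷ _) , _) }) λ ()
matchingBallotFrom⇔ballotWalk x (suc y) (C ∷ w) =
  matchingBallotFrom⇔ballotWalk x y w
    ⇔-∘ matchingBallotFrom-∷ C w (z≤n , s≤s z≤n) (λ shift → offset-C shift x y)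

theorem4p3 : (n : ℕ) → 1 ≤ n → ballotMatching n ≡ R n
theorem4p3 n _ = begin
  ballotMatching n
    ≡⟨ count-⇔ matchingBallot? (ballotWalk? 1 1)
               (All.universal (matchingBallotFrom⇔ballotWalk 0 0) (allWords cands n)) ⟩
  ballotWalks n 1 1
    ≡⟨ ballotWalks≡branching n 1 1 ⟩
  branching (riordanPaths n) 1 1
    ≡⟨⟩
  R n ∎
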